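{- Let $\tau\ge 2$ be an integer. Let $\mathbf e=(e_0,\dots,e_{\tau-1})$ be a $\tau$-tuple of positive integers, and let $\mathbf a=(a_0,\dots,a_{\tau-1})\in\{ -1,+1\}^{\tau}$. For $u\ge 0$ define $$\Sigma(u)=\sum_{0\le w<u}e_{w\bmod \tau},\qquad \Sigma'(u)=\sum_{0\le w<u}e_{(\tau-1-w)\bmod\tau}.$$ Put $$N=\sum_{0\le w<\tau}3^w\,2^{\Sigma'(\tau-1-w)}\,a_w,\qquad D=2^{\Sigma'(\tau)}-3^{\tau}.$$ Note that $D$ is coprime to $2$ and to $3$. Let $\rho_3$ be the unique integer in $\{0,\dots,3^\tau-1\}$ with $\rho_3D\equiv N\pmod{3^\tau}$, and let $\rho_2$ be the unique integer in $\{0,\dots,2^{\Sigma'(\tau)}-1\}$ with $\rho_2 D\equiv N\pmod{2^{\Sigma'(\tau)}}$. Define $$\tilde\rho_3=\sum_{0\le w<\tau}(-1)^{\Sigma(w+1)}\,3^w a_w\sum_{0\le y<\tau-w}\binom{\Sigma(w+1)-1+y}{y}3^y,$$ $$\tilde\rho_2=\sum_{0\le w<\tau}(-1)^{w}\,2^{\Sigma'(w)}\,a_{\tau-1-w}\sum_{0\le y<\eta_w}\binom{w+y}{y}4^y,\qquad \eta_w=\left\lceil \frac{\Sigma(\tau-w)}{2}\right\rceil.$$ Then $$\tilde\rho_3\equiv\rho_3\pmod{3^{\tau}}\quad\text{and}\quad \tilde\rho_2\equiv\rho_2\pmod{2^{\Sigma'(\tau)}}.$$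
   Context: For $\mathbf e=(1,\dots,1,e)$ and $\mathbf a=(1,\dots,1)$, the number $N$ equals $(2^e+1)3^{\tau-1}-2^{e+\tau-1}$. -}

module Defs where

open import Data.Nat as ℕ using (ℕ; zero; suc; _∸_; _%_; ⌈_/2⌉)
open import Data.Nat.DivMod using (m%n<n)
open import Data.Nat.Combinatorics using (_C_)
open import Data.Fin using (Fin; fromℕ<)
open import Data.Integer as ℤ using (ℤ; +_; -1ℤ)

sumℤ : ℕ → (ℕ → ℤ) → ℤ
sumℤ zero    f = + 0
sumℤ (suc n) f = sumℤ n f ℤ.+ f n

sumℕ : ℕ → (ℕ → ℕ) → ℕ
sumℕ zero    f = 0
sumℕ (suc n) f = sumℕ n f ℕ.+ f n

-- e_{w mod τ} for e : Fin τ → ℕ  (τ = 0 case is irrelevant, gives 0)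
eMod : ∀ {τ} → (Fin τ → ℕ) → ℕ → ℕ
eMod {zero}  e w = 0
eMod {suc t} e w = e (fromℕ< (m%n<n w (suc t)))

-- e_{(τ-1-w) mod τ} = e_{τ-1-(w mod τ)}
eModRev : ∀ {τ} → (Fin τ → ℕ) → ℕ → ℕ
eModRev {zero}  e w = 0
eModRev {suc t} e w = eMod e (t ∸ (w % suc t))

Sig : ∀ {τ} → (Fin τ → ℕ) → ℕ → ℕ
Sig e u = sumℕ u (eMod e)

Sig' : ∀ {τ} → (Fin τ → ℕ) → ℕ → ℕ
Sig' e u = sumℕ u (eModRev e)

aAt : ∀ {τ} → (Fin τ → ℤ) → ℕ → ℤ
aAt {zero}  a w = + 0
aAt {suc t} a w = a (fromℕ< (m%n<n w (suc t)))

Nval : (τ : ℕ) → (Fin τ → ℕ) → (Fin τ → ℤ) → ℤ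
Nval τ e a = sumℤ τ (λ w → + (3 ℕ.^ w ℕ.* 2 ℕ.^ Sig' e (τ ∸ 1 ∸ w)) ℤ.* aAt a w)

Dval : (τ : ℕ) → (Fin τ → ℕ) → ℤ
Dval τ e = + (2 ℕ.^ Sig' e τ) ℤ.- + (3 ℕ.^ τ)

rho3~ : (τ : ℕ) → (Fin τ → ℕ) → (Fin τ → ℤ) → ℤ
rho3~ τ e a = sumℤ τ (λ w →
  (-1ℤ ℤ.^ Sig e (suc w)) ℤ.* + (3 ℕ.^ w) ℤ.* aAt a w ℤ.*
  + sumℕ (τ ∸ w) (λ y → ((Sig e (suc w) ∸ 1 ℕ.+ y) C y) ℕ.* 3 ℕ.^ y))

eta : (τ : ℕ) → (Fin τ → ℕ) → ℕ → ℕ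
eta τ e w = ⌈ Sig e (τ ∸ w) /2⌉

rho2~ : (τ : ℕ) → (Fin τ → ℕ) → (Fin τ → ℤ) → ℤ
rho2~ τ e a = sumℤ τ (λ w →
  (-1ℤ ℤ.^ w) ℤ.* + (2 ℕ.^ Sig' e w) ℤ.* aAt a (τ ∸ 1 ∸ w) ℤ.*
  + sumℕ (eta τ e w) (λ y → ((w ℕ.+ y) C y) ℕ.* 4 ℕ.^ y))

{-# OPTIONS --safe #-}
module Submission where

-- Put P = 2^Σ'(τ) and M = 3^τ, so that D ≡ P (mod M) and D ≡ -M (mod P): ρ₃ and ρ₂
-- are the solutions of P ρ ≡ N (mod M) and -M ρ ≡ N (mod P), where P and M are units.
-- Both ρ̃ are built from the truncations B_K(x) = Σ_{y<m} C(K+y,y) x^y of the series of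
-- (1 - x)^-(K+1), which satisfy (1 - x)^(K+1) B_K(x) ≡ 1 (mod x^m). With x = 3 this shows
-- that P times the w-th summand of ρ̃₃ is the w-th summand of N modulo 3^τ; with x = 4
-- and 2^Σ(τ-w) ∣ 4^η_w, that -M times the w-th summand of ρ̃₂ is the (τ-1-w)-th summand
-- of N modulo P.

module _ where
  open import Defs
  open import Data.Nat as ℕ using (ℕ; zero; suc; _∸_; _≤_; _<_; ⌈_/2⌉)
  import Data.Nat.Properties as ℕ
  open import Data.Nat.Combinatorics using (_C_; nCk+nC[k+1]≡[n+1]C[k+1]; nCn≡1)
  open import Data.Nat.DivMod using (m≤n⇒m%n≡m)
  open import Data.Fin using (Fin)
  open import Data.Integer as ℤ using (ℤ; +_; -1ℤ; _-_; _*_; _+_; -_; _^_)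
  import Data.Integer.Properties as ℤ
  import Data.Integer.Divisibility as Unsigned
  open import Data.Integer.Divisibility.Signed
  open import Data.Integer.Tactic.RingSolver using (solve-∀)
  open import Relation.Binary.PropositionalEquality

  pos-^ : ∀ b n → + (b ℕ.^ n) ≡ (+ b) ^ n
  pos-^ b zero    = refl
  pos-^ b (suc n) = trans (ℤ.pos-* b (b ℕ.^ n)) (cong (+ b *_) (pos-^ b n))

  pos-^-+ : ∀ b m n → + (b ℕ.^ (m ℕ.+ n)) ≡ + (b ℕ.^ m) * + (b ℕ.^ n)
  pos-^-+ b m n = trans (cong +_ (ℕ.^-distribˡ-+-* b m n)) (ℤ.pos-* (b ℕ.^ m) (b ℕ.^ n))

  ^-distribʳ-* : ∀ x y n → (x * y) ^ n ≡ x ^ n * y ^ n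
  ^-distribʳ-* x y zero    = refl
  ^-distribʳ-* x y (suc n) = trans (cong (x * y *_) (^-distribʳ-* x y n)) (swap x y (x ^ n) (y ^ n))
    where
    swap : ∀ x y p q → x * y * (p * q) ≡ x * p * (y * q)
    swap = solve-∀

  -1^n*b^n≡[-b]^n : ∀ b n → -1ℤ ^ n * + (b ℕ.^ n) ≡ (- + b) ^ n
  -1^n*b^n≡[-b]^n b n = begin
    -1ℤ ^ n * + (b ℕ.^ n)   ≡⟨ cong (-1ℤ ^ n *_) (pos-^ b n) ⟩
    -1ℤ ^ n * (+ b) ^ n     ≡⟨ ^-distribʳ-* -1ℤ (+ b) n ⟨
    (-1ℤ * + b) ^ n         ≡⟨ cong (_^ n) (ℤ.-1*i≡-i (+ b)) ⟩
    (- + b) ^ n             ∎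
    where open ≡-Reasoning

  2^m∣4^n : ∀ {m n} → m ≤ n ℕ.+ n → (+ 2) ^ m ∣ (+ 4) ^ n
  2^m∣4^n {m} {n} m≤2n = subst ((+ 2) ^ m ∣_) 2^[n+n]≡4^n (∣m⇒∣m*n _ ∣-refl)
    where
    2^[n+n]≡4^n : (+ 2) ^ m * (+ 2) ^ (n ℕ.+ n ∸ m) ≡ (+ 4) ^ n
    2^[n+n]≡4^n = begin
      (+ 2) ^ m * (+ 2) ^ (n ℕ.+ n ∸ m)  ≡⟨ ℤ.^-distribˡ-+-* (+ 2) m _ ⟨
      (+ 2) ^ (m ℕ.+ (n ℕ.+ n ∸ m))      ≡⟨ cong ((+ 2) ^_) (ℕ.m+[n∸m]≡n m≤2n) ⟩
      (+ 2) ^ (n ℕ.+ n)                  ≡⟨ ℤ.^-distribˡ-+-* (+ 2) n n ⟩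
      (+ 2) ^ n * (+ 2) ^ n              ≡⟨ ^-distribʳ-* (+ 2) (+ 2) n ⟨
      (+ 4) ^ n                          ∎
      where open ≡-Reasoning

  n≤⌈n/2⌉+⌈n/2⌉ : ∀ n → n ≤ ⌈ n /2⌉ ℕ.+ ⌈ n /2⌉
  n≤⌈n/2⌉+⌈n/2⌉ n = subst (_≤ ⌈ n /2⌉ ℕ.+ ⌈ n /2⌉) (ℕ.⌊n/2⌋+⌈n/2⌉≡n n)
                      (ℕ.+-monoˡ-≤ ⌈ n /2⌉ (ℕ.⌊n/2⌋≤⌈n/2⌉ n))

  negBinomialSeries : ℤ → ℕ → ℕ → ℤ
  negBinomialSeries x K m = sumℤ m (λ y → + ((K ℕ.+ y) C y) * x ^ y)

  -- C(K+m, m-1), with value 0 (rather than C(K,0)) at m = 0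
  choosePred : ℕ → ℕ → ℕ
  choosePred K zero    = 0
  choosePred K (suc m) = (suc K ℕ.+ m) C m

  pascal : ∀ K m → (suc K ℕ.+ m) C m ≡ (K ℕ.+ m) C m ℕ.+ choosePred K m
  pascal K zero    = refl
  pascal K (suc m) rewrite ℕ.+-suc K m =
    trans (sym (nCk+nC[k+1]≡[n+1]C[k+1] n m))
          (ℕ.+-comm (n C m) (n C suc m))
    where n = suc (K ℕ.+ m)

  negBinomialSeries-step : ∀ x K m →
    (+ 1 - x) * negBinomialSeries x (suc K) m + x ^ m * + choosePred K m ≡ negBinomialSeries x K m
  negBinomialSeries-step x K zero = empty x
    where
    empty : ∀ x → (+ 1 - x) * + 0 + + 1 * + 0 ≡ + 0
    empty = solve-∀
  negBinomialSeries-step x K (suc m) = begin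
      (+ 1 - x) * (B₁ + + C₁ * x ^ m) + x * x ^ m * + C₁
    ≡⟨ cong (λ C → (+ 1 - x) * (B₁ + C * x ^ m) + x * x ^ m * C) C₁≡ ⟩
      (+ 1 - x) * (B₁ + (C₀ + c) * x ^ m) + x * x ^ m * (C₀ + c)
    ≡⟨ regroup B₁ C₀ c x (x ^ m) ⟩
      ((+ 1 - x) * B₁ + x ^ m * c) + C₀ * x ^ m
    ≡⟨ cong (_+ C₀ * x ^ m) (negBinomialSeries-step x K m) ⟩
      negBinomialSeries x K m + C₀ * x ^ m ∎
    where
    open ≡-Reasoning
    C₁ : ℕ
    C₁ = (suc K ℕ.+ m) C m
    B₁ C₀ c : ℤ
    B₁ = negBinomialSeries x (suc K) m
    C₀ = + ((K ℕ.+ m) C m)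
    c  = + choosePred K m
    C₁≡ : + C₁ ≡ C₀ + c
    C₁≡ = trans (cong +_ (pascal K m)) (ℤ.pos-+ ((K ℕ.+ m) C m) (choosePred K m))
    regroup : ∀ b C₀ c x p →
      (+ 1 - x) * (b + (C₀ + c) * p) + x * p * (C₀ + c) ≡ ((+ 1 - x) * b + p * c) + C₀ * p
    regroup = solve-∀

  geometricSeries : ∀ x m → (+ 1 - x) * negBinomialSeries x 0 m + x ^ m ≡ + 1
  geometricSeries x zero = empty x
    where
    empty : ∀ x → (+ 1 - x) * + 0 + + 1 ≡ + 1
    empty = solve-∀
  geometricSeries x (suc m) rewrite nCn≡1 m =
    trans (regroup (negBinomialSeries x 0 m) x (x ^ m)) (geometricSeries x m)
    where
    regroup : ∀ b x p → (+ 1 - x) * (b + + 1 * p) + x * p ≡ (+ 1 - x) * b + p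
    regroup = solve-∀

  negBinomialSeries-inverse : ∀ x K m → x ^ m ∣ (+ 1 - x) ^ suc K * negBinomialSeries x K m - + 1
  negBinomialSeries-inverse x zero m =
    subst (x ^ m ∣_) (sym eq) (∣m⇒∣-m ∣-refl)
    where
    open ≡-Reasoning
    B : ℤ
    B = negBinomialSeries x 0 m
    regroup : ∀ a b p → a * + 1 * b - + 1 ≡ (a * b + p) - + 1 - p
    regroup = solve-∀
    cancel : ∀ p → + 1 - + 1 - p ≡ - p
    cancel = solve-∀
    eq : (+ 1 - x) ^ 1 * B - + 1 ≡ - x ^ m
    eq = begin
      (+ 1 - x) ^ 1 * B - + 1                ≡⟨ regroup (+ 1 - x) B (x ^ m) ⟩
      ((+ 1 - x) * B + x ^ m) - + 1 - x ^ m  ≡⟨ cong (λ s → s - + 1 - x ^ m) (geometricSeries x m) ⟩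
      + 1 - + 1 - x ^ m                      ≡⟨ cancel (x ^ m) ⟩
      - x ^ m                                ∎
  negBinomialSeries-inverse x (suc K) m =
    subst (x ^ m ∣_) (sym eq) (∣m∣n⇒∣m-n (negBinomialSeries-inverse x K m) (∣m⇒∣m*n _ ∣-refl))
    where
    open ≡-Reasoning
    u B₀ B₁ c : ℤ
    u  = + 1 - x
    B₀ = negBinomialSeries x K m
    B₁ = negBinomialSeries x (suc K) m
    c  = + choosePred K m
    regroup : ∀ u q b₁ p c → u * q * b₁ - + 1 ≡ (q * (u * b₁ + p * c) - + 1) - p * (c * q)
    regroup = solve-∀
    eq : u ^ suc (suc K) * B₁ - + 1 ≡ (u ^ suc K * B₀ - + 1) - x ^ m * (c * u ^ suc K)
    eq = begin
      u * u ^ suc K * B₁ - + 1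
        ≡⟨ regroup u (u ^ suc K) B₁ (x ^ m) c ⟩
      (u ^ suc K * (u * B₁ + x ^ m * c) - + 1) - x ^ m * (c * u ^ suc K)
        ≡⟨ cong (λ s → (u ^ suc K * s - + 1) - x ^ m * (c * u ^ suc K)) (negBinomialSeries-step x K m) ⟩
      (u ^ suc K * B₀ - + 1) - x ^ m * (c * u ^ suc K) ∎

  negBinomialSeries-pos : ∀ x K m →
    + sumℕ m (λ y → ((K ℕ.+ y) C y) ℕ.* x ℕ.^ y) ≡ negBinomialSeries (+ x) K m
  negBinomialSeries-pos x K zero    = refl
  negBinomialSeries-pos x K (suc m) = trans (ℤ.pos-+ (sumℕ m _) (c ℕ.* x ℕ.^ m))
    (cong₂ _+_ (negBinomialSeries-pos x K m)
               (trans (ℤ.pos-* c (x ℕ.^ m)) (cong (+ c *_) (pos-^ x m))))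
    where
    c : ℕ
    c = (K ℕ.+ m) C m

  ∣-sumℤ-difference : ∀ {d} n f g → (∀ i → i < n → d ∣ f i - g i) → d ∣ sumℤ n f - sumℤ n g
  ∣-sumℤ-difference zero    f g _ = divides (+ 0) refl
  ∣-sumℤ-difference (suc n) f g d∣ =
    subst (_ ∣_) (sym (regroup (sumℤ n f) (f n) (sumℤ n g) (g n)))
      (∣m∣n⇒∣m+n (∣-sumℤ-difference n f g (λ i i<n → d∣ i (ℕ.m<n⇒m<1+n i<n))) (d∣ n ℕ.≤-refl))
    where
    regroup : ∀ s x t y → (s + x) - (t + y) ≡ (s - t) + (x - y)
    regroup = solve-∀

  *-distribˡ-sumℤ : ∀ c n f → c * sumℤ n f ≡ sumℤ n (λ i → c * f i)
  *-distribˡ-sumℤ c zero    f = ℤ.*-zeroʳ c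
  *-distribˡ-sumℤ c (suc n) f =
    trans (ℤ.*-distribˡ-+ c (sumℤ n f) (f n)) (cong (_+ c * f n) (*-distribˡ-sumℤ c n f))

  sumℤ-suc : ∀ n f → sumℤ (suc n) f ≡ f 0 + sumℤ n (λ i → f (suc i))
  sumℤ-suc zero    f = ℤ.+-comm (+ 0) (f 0)
  sumℤ-suc (suc n) f = trans (cong (_+ f (suc n)) (sumℤ-suc n f)) (ℤ.+-assoc (f 0) _ _)

  sumℤ-reverse : ∀ n f → sumℤ n f ≡ sumℤ n (λ i → f (n ∸ suc i))
  sumℤ-reverse zero    f = refl
  sumℤ-reverse (suc n) f = trans (cong (_+ f n) (sumℤ-reverse n f))
    (trans (ℤ.+-comm _ (f n)) (sym (sumℤ-suc n (λ i → f (suc n ∸ suc i)))))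

  ∣-cancelˡ-unit : ∀ {m u v z} → m ∣ u * v - + 1 → m ∣ u * z → m ∣ z
  ∣-cancelˡ-unit {m} {u} {v} {z} m∣uv-1 m∣uz =
    subst (m ∣_) (sym (regroup u v z)) (∣m∣n⇒∣m-n (∣n⇒∣m*n v m∣uz) (∣m⇒∣m*n z m∣uv-1))
    where
    regroup : ∀ u v z → z ≡ v * (u * z) - (u * v - + 1) * z
    regroup = solve-∀

  congruence-solution-unique : ∀ {m u v x y n} →
    m ∣ u * v - + 1 → m ∣ u * x - n → m ∣ u * y - n → m ∣ x - y
  congruence-solution-unique {m} {u} {v} {x} {y} {n} unit m∣ux-n m∣uy-n =
    ∣-cancelˡ-unit {u = u} unit (subst (m ∣_) (sym (regroup u x y n)) (∣m∣n⇒∣m-n m∣ux-n m∣uy-n))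
    where
    regroup : ∀ u x y n → u * (x - y) ≡ (u * x - n) - (u * y - n)
    regroup = solve-∀

  congruence-coefficient : ∀ {m u u′ x n} → m ∣ u′ - u → m ∣ x * u′ - n → m ∣ u * x - n
  congruence-coefficient {m} {u} {u′} {x} {n} m∣u′-u m∣xu′-n =
    subst (m ∣_) (sym (regroup u u′ x n)) (∣m∣n⇒∣m-n m∣xu′-n (∣n⇒∣m*n x m∣u′-u))
    where
    regroup : ∀ u u′ x n → u * x - n ≡ (x * u′ - n) - x * (u′ - u)
    regroup = solve-∀

  eModRev≡eMod : ∀ {t} (e : Fin (suc t) → ℕ) v → v ≤ t → eModRev e v ≡ eMod e (t ∸ v)
  eModRev≡eMod {t} e v v≤t = cong (λ r → eMod e (t ∸ r)) (m≤n⇒m%n≡m v≤t)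

  Sig'-split : ∀ {t} (e : Fin (suc t) → ℕ) m n →
    n ℕ.+ m ≡ suc t → Sig' e (suc t) ≡ Sig' e n ℕ.+ Sig e m
  Sig'-split e zero n n+0≡τ = trans (cong (Sig' e) (trans (sym n+0≡τ) (ℕ.+-identityʳ n)))
                                    (sym (ℕ.+-identityʳ (Sig' e n)))
  Sig'-split {t} e (suc m) n n+m+1≡τ = begin
      Sig' e (suc t)
    ≡⟨ Sig'-split e m (suc n) (trans (sym (ℕ.+-suc n m)) n+m+1≡τ) ⟩
      Sig' e n ℕ.+ eModRev e n ℕ.+ Sig e m
    ≡⟨ cong (λ s → Sig' e n ℕ.+ s ℕ.+ Sig e m)
            (trans (eModRev≡eMod e n n≤t) (cong (eMod e) t∸n≡m)) ⟩
      Sig' e n ℕ.+ eMod e m ℕ.+ Sig e m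
    ≡⟨ ℕ.+-assoc (Sig' e n) (eMod e m) (Sig e m) ⟩
      Sig' e n ℕ.+ (eMod e m ℕ.+ Sig e m)
    ≡⟨ cong (Sig' e n ℕ.+_) (ℕ.+-comm (eMod e m) (Sig e m)) ⟩
      Sig' e n ℕ.+ Sig e (suc m) ∎
    where
    open ≡-Reasoning
    n+m≡t : n ℕ.+ m ≡ t
    n+m≡t = ℕ.suc-injective (trans (sym (ℕ.+-suc n m)) n+m+1≡τ)
    n≤t : n ≤ t
    n≤t = subst (n ≤_) n+m≡t (ℕ.m≤m+n n m)
    t∸n≡m : t ∸ n ≡ m
    t∸n≡m = trans (cong (_∸ n) (sym n+m≡t)) (ℕ.m+n∸m≡n n m)

  module _ (t : ℕ) (e : Fin (suc t) → ℕ) (e-pos : ∀ i → 1 ≤ e i) (a : Fin (suc t) → ℤ) where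
    private
      τ S : ℕ
      τ = suc t
      S = Sig' e τ

      P M N : ℤ
      P = + (2 ℕ.^ S)
      M = + (3 ℕ.^ τ)
      N = Nval τ e a

      nSummand ρ̃₃-summand ρ̃₂-summand : ℕ → ℤ
      nSummand w = + (3 ℕ.^ w ℕ.* 2 ℕ.^ Sig' e (t ∸ w)) * aAt a w
      ρ̃₃-summand w = -1ℤ ^ Sig e (suc w) * + (3 ℕ.^ w) * aAt a w *
        + sumℕ (τ ∸ w) (λ y → ((Sig e (suc w) ∸ 1 ℕ.+ y) C y) ℕ.* 3 ℕ.^ y)
      ρ̃₂-summand w = -1ℤ ^ w * + (2 ℕ.^ Sig' e w) * aAt a (t ∸ w) *
        + sumℕ (eta τ e w) (λ y → ((w ℕ.+ y) C y) ℕ.* 4 ℕ.^ y)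

    suc-pred-Sig-suc : ∀ w → suc (Sig e (suc w) ∸ 1) ≡ Sig e (suc w)
    suc-pred-Sig-suc w = ℕ.m+[n∸m]≡n (ℕ.≤-trans (e-pos _) (ℕ.m≤n+m (eMod e w) (Sig e w)))

    ρ̃₃-summand-congruence : ∀ w → w < τ → M ∣ P * ρ̃₃-summand w - nSummand w
    ρ̃₃-summand-congruence w w<τ =
      subst₂ _∣_ X*3^[τ-w]≡M (sym expand)
        (*-monoʳ-∣ X (∣n⇒∣m*n (Y * A) (negBinomialSeries-inverse (+ 3) K (τ ∸ w))))
      where
      open ≡-Reasoning
      w≤t : w ≤ t
      w≤t = ℕ.≤-pred w<τ
      k K : ℕ
      k = Sig e (suc w)
      K = k ∸ 1
      X Y Z A B : ℤ
      X = + (3 ℕ.^ w)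
      Y = + (2 ℕ.^ Sig' e (t ∸ w))
      Z = + (2 ℕ.^ k)
      A = aAt a w
      B = negBinomialSeries (+ 3) K (τ ∸ w)
      P≡YZ : P ≡ Y * Z
      P≡YZ = trans (cong (λ s → + (2 ℕ.^ s)) (Sig'-split e (suc w) (t ∸ w)
                     (trans (ℕ.+-suc (t ∸ w) w) (cong suc (ℕ.m∸n+n≡m w≤t)))))
                   (pos-^-+ 2 (Sig' e (t ∸ w)) k)
      [-1]^k*Z≡[-2]^[K+1] : -1ℤ ^ k * Z ≡ (+ 1 - + 3) ^ suc K
      [-1]^k*Z≡[-2]^[K+1] = trans (-1^n*b^n≡[-b]^n 2 k) (cong ((- + 2) ^_) (sym (suc-pred-Sig-suc w)))
      regroup : ∀ X Y Z U A B → (Y * Z) * (U * X * A * B) - X * Y * A ≡ X * (Y * A * (U * Z * B - + 1))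
      regroup = solve-∀
      expand : P * ρ̃₃-summand w - nSummand w ≡ X * (Y * A * ((+ 1 - + 3) ^ suc K * B - + 1))
      expand = begin
          P * ρ̃₃-summand w - nSummand w
        ≡⟨ cong₂ (λ p b → p * (-1ℤ ^ k * X * A * b) - nSummand w)
                 P≡YZ (negBinomialSeries-pos 3 K (τ ∸ w)) ⟩
          (Y * Z) * (-1ℤ ^ k * X * A * B) - nSummand w
        ≡⟨ cong (λ q → (Y * Z) * (-1ℤ ^ k * X * A * B) - q * A)
                (ℤ.pos-* (3 ℕ.^ w) (2 ℕ.^ Sig' e (t ∸ w))) ⟩
          (Y * Z) * (-1ℤ ^ k * X * A * B) - X * Y * A
        ≡⟨ regroup X Y Z (-1ℤ ^ k) A B ⟩
          X * (Y * A * (-1ℤ ^ k * Z * B - + 1))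
        ≡⟨ cong (λ q → X * (Y * A * (q * B - + 1))) [-1]^k*Z≡[-2]^[K+1] ⟩
          X * (Y * A * ((+ 1 - + 3) ^ suc K * B - + 1)) ∎
      X*3^[τ-w]≡M : X * (+ 3) ^ (τ ∸ w) ≡ M
      X*3^[τ-w]≡M = begin
        X * (+ 3) ^ (τ ∸ w)             ≡⟨ cong (X *_) (pos-^ 3 (τ ∸ w)) ⟨
        X * + (3 ℕ.^ (τ ∸ w))           ≡⟨ pos-^-+ 3 w (τ ∸ w) ⟨
        + (3 ℕ.^ (w ℕ.+ (τ ∸ w)))       ≡⟨ cong (λ n → + (3 ℕ.^ n)) (ℕ.m+[n∸m]≡n (ℕ.<⇒≤ w<τ)) ⟩
        M                               ∎

    ρ̃₂-summand-congruence : ∀ v → v < τ → P ∣ (- M) * ρ̃₂-summand v - nSummand (t ∸ v)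
    ρ̃₂-summand-congruence v v<τ =
      subst₂ _∣_ (sym P≡Y*2^m) (sym expand)
        (*-monoʳ-∣ Y (∣n⇒∣m*n (X * A)
          (∣-trans (2^m∣4^n {n = η} (n≤⌈n/2⌉+⌈n/2⌉ m)) (negBinomialSeries-inverse (+ 4) v η))))
      where
      open ≡-Reasoning
      v≤t : v ≤ t
      v≤t = ℕ.≤-pred v<τ
      m η : ℕ
      m = Sig e (τ ∸ v)
      η = eta τ e v
      X Y Z A B : ℤ
      X = + (3 ℕ.^ (t ∸ v))
      Y = + (2 ℕ.^ Sig' e v)
      Z = + (3 ℕ.^ suc v)
      A = aAt a (t ∸ v)
      B = negBinomialSeries (+ 4) v η
      P≡Y*2^m : P ≡ Y * (+ 2) ^ m
      P≡Y*2^m = trans (cong (λ s → + (2 ℕ.^ s))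
                        (Sig'-split e (τ ∸ v) v (ℕ.m+[n∸m]≡n (ℕ.<⇒≤ v<τ))))
                      (trans (pos-^-+ 2 (Sig' e v) m) (cong (Y *_) (pos-^ 2 m)))
      M≡XZ : M ≡ X * Z
      M≡XZ = trans (cong (λ n → + (3 ℕ.^ n))
                     (sym (trans (ℕ.+-suc (t ∸ v) v) (cong suc (ℕ.m∸n+n≡m v≤t)))))
                   (pos-^-+ 3 (t ∸ v) (suc v))
      [-1]^[v+1]*Z≡[-3]^[v+1] : -1ℤ * -1ℤ ^ v * Z ≡ (+ 1 - + 4) ^ suc v
      [-1]^[v+1]*Z≡[-3]^[v+1] = -1^n*b^n≡[-b]^n 3 (suc v)
      regroup : ∀ X Y Z U A B →
        - (X * Z) * (U * Y * A * B) - X * Y * A ≡ Y * (X * A * (-1ℤ * U * Z * B - + 1))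
      regroup = solve-∀
      expand : (- M) * ρ̃₂-summand v - nSummand (t ∸ v)
             ≡ Y * (X * A * ((+ 1 - + 4) ^ suc v * B - + 1))
      expand = begin
          (- M) * ρ̃₂-summand v - nSummand (t ∸ v)
        ≡⟨ cong₂ (λ p b → (- p) * (-1ℤ ^ v * Y * A * b) - nSummand (t ∸ v))
                 M≡XZ (negBinomialSeries-pos 4 v η) ⟩
          - (X * Z) * (-1ℤ ^ v * Y * A * B) - nSummand (t ∸ v)
        ≡⟨ cong (λ q → - (X * Z) * (-1ℤ ^ v * Y * A * B) - q * A)
             (trans (cong (λ r → + (3 ℕ.^ (t ∸ v) ℕ.* 2 ℕ.^ Sig' e r)) (ℕ.m∸[m∸n]≡n v≤t))
                    (ℤ.pos-* (3 ℕ.^ (t ∸ v)) (2 ℕ.^ Sig' e v))) ⟩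
          - (X * Z) * (-1ℤ ^ v * Y * A * B) - X * Y * A
        ≡⟨ regroup X Y Z (-1ℤ ^ v) A B ⟩
          Y * (X * A * (-1ℤ * -1ℤ ^ v * Z * B - + 1))
        ≡⟨ cong (λ q → Y * (X * A * (q * B - + 1))) [-1]^[v+1]*Z≡[-3]^[v+1] ⟩
          Y * (X * A * ((+ 1 - + 4) ^ suc v * B - + 1)) ∎

    ρ̃₃-congruence : M ∣ P * rho3~ τ e a - N
    ρ̃₃-congruence = subst (λ s → M ∣ s - N) (sym (*-distribˡ-sumℤ P τ ρ̃₃-summand))
      (∣-sumℤ-difference τ _ nSummand ρ̃₃-summand-congruence)

    ρ̃₂-congruence : P ∣ (- M) * rho2~ τ e a - N
    ρ̃₂-congruence = subst₂ (λ s n → P ∣ s - n)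
      (sym (*-distribˡ-sumℤ (- M) τ ρ̃₂-summand)) (sym (sumℤ-reverse τ nSummand))
      (∣-sumℤ-difference τ _ (λ v → nSummand (t ∸ v)) ρ̃₂-summand-congruence)

    P-unit : M ∣ P * ((+ 1 - + 3) * -1ℤ ^ S * negBinomialSeries (+ 3) S τ) - + 1
    P-unit = subst₂ _∣_ (sym (pos-^ 3 τ)) (sym expand) (negBinomialSeries-inverse (+ 3) S τ)
      where
      open ≡-Reasoning
      regroup : ∀ c U P B → P * (c * U * B) - + 1 ≡ c * (U * P) * B - + 1
      regroup = solve-∀
      expand : P * ((+ 1 - + 3) * -1ℤ ^ S * negBinomialSeries (+ 3) S τ) - + 1
             ≡ (+ 1 - + 3) ^ suc S * negBinomialSeries (+ 3) S τ - + 1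
      expand = begin
          P * ((+ 1 - + 3) * -1ℤ ^ S * negBinomialSeries (+ 3) S τ) - + 1
        ≡⟨ regroup (+ 1 - + 3) (-1ℤ ^ S) P (negBinomialSeries (+ 3) S τ) ⟩
          (+ 1 - + 3) * (-1ℤ ^ S * P) * negBinomialSeries (+ 3) S τ - + 1
        ≡⟨ cong (λ q → (+ 1 - + 3) * q * negBinomialSeries (+ 3) S τ - + 1) (-1^n*b^n≡[-b]^n 2 S) ⟩
          (+ 1 - + 3) ^ suc S * negBinomialSeries (+ 3) S τ - + 1 ∎

    -M-unit : P ∣ (- M) * - (-1ℤ ^ τ * negBinomialSeries (+ 4) t S) - + 1
    -M-unit = subst₂ _∣_ (sym (pos-^ 2 S)) (sym expand)
      (∣-trans (2^m∣4^n {n = S} (ℕ.m≤m+n S S)) (negBinomialSeries-inverse (+ 4) t S))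
      where
      regroup : ∀ M W B → (- M) * - (W * B) - + 1 ≡ W * M * B - + 1
      regroup = solve-∀
      expand : (- M) * - (-1ℤ ^ τ * negBinomialSeries (+ 4) t S) - + 1
             ≡ (+ 1 - + 4) ^ τ * negBinomialSeries (+ 4) t S - + 1
      expand = trans (regroup M (-1ℤ ^ τ) (negBinomialSeries (+ 4) t S))
        (cong (λ q → q * negBinomialSeries (+ 4) t S - + 1) (-1^n*b^n≡[-b]^n 3 τ))

    rho3~-correct : ∀ ρ → M Unsigned.∣ + ρ * Dval τ e - N → M Unsigned.∣ rho3~ τ e a - + ρ
    rho3~-correct ρ M∣ρD-N = ∣⇒∣ᵤ (congruence-solution-unique {u = P} P-unit ρ̃₃-congruence
      (congruence-coefficient {u′ = Dval τ e} {x = + ρ} M∣D-P (∣ᵤ⇒∣ M∣ρD-N)))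
      where
      regroup : ∀ P M → (P - M) - P ≡ - M
      regroup = solve-∀
      M∣D-P : M ∣ Dval τ e - P
      M∣D-P = subst (M ∣_) (sym (regroup P M)) (∣m⇒∣-m ∣-refl)

    rho2~-correct : ∀ ρ → P Unsigned.∣ + ρ * Dval τ e - N → P Unsigned.∣ rho2~ τ e a - + ρ
    rho2~-correct ρ P∣ρD-N = ∣⇒∣ᵤ (congruence-solution-unique {u = - M} -M-unit ρ̃₂-congruence
      (congruence-coefficient {u′ = Dval τ e} {x = + ρ} P∣D+M (∣ᵤ⇒∣ P∣ρD-N)))
      where
      regroup : ∀ P M → (P - M) - - M ≡ P
      regroup = solve-∀
      P∣D+M : P ∣ Dval τ e - - M
      P∣D+M = subst (P ∣_) (sym (regroup P M)) ∣-refl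

open import Defs
open import Data.Nat using (ℕ; _≤_; _<_; _^_; suc)
open import Data.Fin using (Fin)
open import Data.Integer using (ℤ; +_; -1ℤ; _-_; _*_)
open import Data.Integer.Divisibility using (_∣_)
open import Data.Product using (_×_; _,_)
open import Data.Sum using (_⊎_)
open import Relation.Binary.PropositionalEquality using (_≡_)

mainTheorem4 : (τ : ℕ) → 2 ≤ τ →
    (e : Fin τ → ℕ) → (∀ i → 1 ≤ e i) →
    (a : Fin τ → ℤ) → (∀ i → a i ≡ + 1 ⊎ a i ≡ -1ℤ) →
    (∀ (ρ₃ : ℕ) → ρ₃ < 3 ^ τ →
        + (3 ^ τ) ∣ (+ ρ₃ * Dval τ e - Nval τ e a) →
        + (3 ^ τ) ∣ (rho3~ τ e a - + ρ₃))
    × (∀ (ρ₂ : ℕ) → ρ₂ < 2 ^ Sig' e τ →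
        + (2 ^ Sig' e τ) ∣ (+ ρ₂ * Dval τ e - Nval τ e a) →
        + (2 ^ Sig' e τ) ∣ (rho2~ τ e a - + ρ₂))
mainTheorem4 (suc t) _ e e-pos a _ =
  (λ ρ _ → rho3~-correct t e e-pos a ρ) , (λ ρ _ → rho2~-correct t e e-pos a ρ)
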